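{- Let $T$ be a tree and $\mathcal{P}$ a set of non-trivial simple paths in $T$, and let $\mathrm{ENPT}(T,\mathcal{P})$ be the graph defined below. Then for every non-empty clique $K$ of $\mathrm{ENPT}(T,\mathcal{P})$ there is an edge $e$ of $T$ that belongs to every path $P_v$ with $v \in K$ (i.e. $K$ corresponds to an edge-clique), and moreover the union $\bigcup_{v\in K} P_v$ is a path in $T$.
   Context: Given a tree $T$ and a set $\mathcal{P}=\{P_v\}$ of non-trivial simple paths in $T$ (each path has at least one edge), two paths $P,P'$ edge-intersect if they share an edge. The split vertices of $P,P'$ are the vertices of degree at least $3$ in the union graph $P\cup P'$. Two paths are non-splitting ($P\sim P'$) if they edge-intersect and have no split vertices (equivalently, in a tree, their union is a path). The graph $\mathrm{ENPT}(T,\mathcal{P})$ has one vertex $v$ for each path $P_v\in\mathcal{P}$, and $u,v$ are adjacent iff $P_u\sim P_v$. An edge-clique is a set of paths all containing a common edge $e$ of $T$. -}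

module Defs where

open import Level using (0ℓ)
open import Data.Nat using (ℕ; _≤_)
open import Data.Fin using (Fin)
open import Data.Fin.Subset using (Subset; _∈_)
open import Data.List using (List; []; _∷_; length; _∷ʳ_)
open import Data.List.Relation.Unary.Unique.Propositional using (Unique)
open import Data.List.Relation.Unary.Linked using (Linked)
open import Data.Product using (Σ; ∃; ∃-syntax; _×_; _,_)
open import Data.Sum using (_⊎_)
open import Relation.Nullary using (¬_)
open import Relation.Binary using (Decidable)
open import Relation.Binary.PropositionalEquality using (_≡_; _≢_)
open import Function.Bundles using (_⇔_)

record SimpleGraph (n : ℕ) : Set₁ where
  field
    Adj     : Fin n → Fin n → Set
    adj?    : Decidable Adj
    symm    : ∀ {u v} → Adj u v → Adj v u
    irrefl  : ∀ {u} → ¬ Adj u u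
open SimpleGraph public

module _ {n : ℕ} (G : SimpleGraph n) where

  data Walk : Fin n → Fin n → Set where
    nil  : ∀ {u} → Walk u u
    cons : ∀ {u w v} → Adj G u w → Walk w v → Walk u v

  Connected : Set
  Connected = ∀ u v → Walk u v

  -- a cycle: distinct vertices x, ys..., y (at least 3 of them),
  -- consecutive ones adjacent, and y adjacent to x
  HasCycle : Set
  HasCycle = ∃[ x ] ∃[ ys ] ∃[ y ]
    ( Unique (x ∷ ys ∷ʳ y) × Linked (Adj G) (x ∷ ys ∷ʳ y)
    × ys ≢ [] × Adj G y x )

  IsTree : Set
  IsTree = Connected × ¬ HasCycle

  record Path : Set where
    constructor mkPath
    field
      verts    : List (Fin n)
      distinct : Unique verts
      linked   : Linked (Adj G) verts
      nontriv  : 2 ≤ length verts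
  open Path public

data EdgeOn {n : ℕ} (a b : Fin n) : List (Fin n) → Set where
  here  : ∀ {xs} → EdgeOn a b (a ∷ b ∷ xs)
  here′ : ∀ {xs} → EdgeOn a b (b ∷ a ∷ xs)
  there : ∀ {x xs} → EdgeOn a b xs → EdgeOn a b (x ∷ xs)

module _ {n : ℕ} {G : SimpleGraph n} where

  _∈E_ : Fin n × Fin n → Path G → Set
  (a , b) ∈E P = EdgeOn a b (verts P)

  EdgeIntersect : Path G → Path G → Set
  EdgeIntersect P P' = ∃[ a ] ∃[ b ] ((a , b) ∈E P × (a , b) ∈E P')

  UnionAdj : Path G → Path G → Fin n → Fin n → Set
  UnionAdj P P' u w = (u , w) ∈E P ⊎ (u , w) ∈E P'

  SplitVertex : Path G → Path G → Fin n → Set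
  SplitVertex P P' u = ∃[ w₁ ] ∃[ w₂ ] ∃[ w₃ ]
    ( w₁ ≢ w₂ × w₁ ≢ w₃ × w₂ ≢ w₃
    × UnionAdj P P' u w₁ × UnionAdj P P' u w₂ × UnionAdj P P' u w₃ )

  _∼_ : Path G → Path G → Set
  P ∼ P' = EdgeIntersect P P' × ¬ (∃[ u ] SplitVertex P P' u)

  ENPTAdj : {m : ℕ} → (Fin m → Path G) → Fin m → Fin m → Set
  ENPTAdj 𝒫 u v = u ≢ v × 𝒫 u ∼ 𝒫 v

  IsClique : {m : ℕ} → (Fin m → Path G) → Subset m → Set
  IsClique 𝒫 K = ∀ u v → u ∈ K → v ∈ K → u ≢ v → ENPTAdj 𝒫 u v

module Submission where

-- An edge of W is located by its position in W, which is unique when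
-- W has no repeated vertex.  Contiguous blocks of W that pairwise share an edge
-- therefore form pairwise overlapping intervals of positions, and the first edge of the
-- block that starts last lies in every block.
--
-- Let W and P be simple paths sharing an edge, P not branching off W.
-- Walking from the shared edge forwards and backwards, the two lists agree until one of
-- them ends; the longer left part followed by the longer right part is a walk that
-- never backtracks, and in a graph without cycles such a walk is simple.  W and (an
-- orientation of) P are contiguous pieces of it, and it has no other edges.
--
-- Non-splitting paths do not branch off each other, so merging the paths of the clique
-- one at a time yields a path Q with exactly their edges, each path being a block of Q.
-- Members of a clique pairwise share an edge, and the Helly property gives the common
-- edge.

open import Data.Nat using (ℕ; suc; _≤_; _+_; s≤s; z≤n)
open import Data.Nat.Properties
  using (≤-trans; ≤-refl; <⇒≤; ≰⇒>; _≤?_; +-monoˡ-≤; +-comm; m≢1+n+m)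
open import Data.Fin using (Fin; _≟_)
open import Data.Fin.Subset using (Subset; _∈_)
open import Data.Fin.Subset.Properties using (_∈?_)
open import Data.List using (List; []; _∷_; _++_; _∷ʳ_; reverse; length; filter; allFin; initLast; _∷ʳ′_)
open import Data.List.Properties
  using (∷-injectiveˡ; ∷-injectiveʳ; ++-assoc; ++-identityʳ; reverse-++; unfold-reverse; reverse-involutive; ∷ʳ-++; length-++; length-++-≤ˡ)
open import Data.List.Relation.Unary.All as All using (All; []; _∷_)
import Data.List.Relation.Unary.All.Properties as AllP
open import Data.List.Relation.Unary.AllPairs using (AllPairs; []; _∷_)
open import Data.List.Relation.Unary.Any using (here; there)
open import Data.List.Relation.Unary.Unique.Propositional using (Unique)
import Data.List.Relation.Unary.Unique.Propositional.Properties as UniqueP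
open import Data.List.Relation.Unary.Linked as Linked using (Linked; []; [-]; _∷_)
open import Data.List.Relation.Binary.Permutation.Propositional using (↭-sym; ↭⇒↭ₛ)
open import Data.List.Relation.Binary.Permutation.Propositional.Properties using (↭-reverse)
import Data.List.Relation.Binary.Permutation.Setoid.Properties as PermutationSetoid
open import Data.List.Membership.Propositional using () renaming (_∈_ to _∈L_; _∉_ to _∉L_)
open import Data.List.Membership.Propositional.Properties using (∈-++⁺ʳ; ∈-∃++; ∈-filter⁺; ∈-filter⁻; ∈-allFin)
open import Data.Product using (Σ; ∃; ∃₂; ∃-syntax; _×_; _,_; proj₁; proj₂)
open import Data.Sum using (_⊎_; inj₁; inj₂; [_,_]′) renaming (map to ⊎-map; swap to ⊎-swap)
open import Data.Empty using (⊥; ⊥-elim)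
open import Data.Unit using (⊤; tt)
open import Relation.Nullary using (¬_; yes; no)
open import Relation.Binary.PropositionalEquality
  using (_≡_; _≢_; refl; sym; trans; cong; cong₂; subst; setoid; module ≡-Reasoning)
open import Function using (id; _∘_)
open import Function.Bundles using (_⇔_; mk⇔)
open import Defs

module _ {A : Set} where

  open PermutationSetoid (setoid A) using (Unique-resp-↭)

  unique-++ˡ : ∀ (xs : List A) {ys} → Unique (xs ++ ys) → Unique xs
  unique-++ˡ []       _          = []
  unique-++ˡ (x ∷ xs) (x∉ ∷ u) = AllP.++⁻ˡ xs x∉ ∷ unique-++ˡ xs u

  unique-++ʳ : ∀ (xs : List A) {ys} → Unique (xs ++ ys) → Unique ys
  unique-++ʳ []       u       = u
  unique-++ʳ (x ∷ xs) (_ ∷ u) = unique-++ʳ xs u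

  unique-disjoint : ∀ (xs : List A) {ys x} → Unique (xs ++ ys) → x ∈L xs → x ∉L ys
  unique-disjoint (y ∷ xs) (y∉ ∷ _) (here refl) x∈ys = All.lookup (AllP.++⁻ʳ xs y∉) x∈ys refl
  unique-disjoint (y ∷ xs) (_ ∷ u)  (there x∈xs) x∈ys = unique-disjoint xs u x∈xs x∈ys

  unique-reverse : ∀ {xs : List A} → Unique xs → Unique (reverse xs)
  unique-reverse {xs} = Unique-resp-↭ (↭⇒↭ₛ (↭-sym (↭-reverse xs)))

  unique-prefix : ∀ (U : List A) {x V U′ V′} → Unique (U ++ x ∷ V) →
                  U ++ x ∷ V ≡ U′ ++ x ∷ V′ → U ≡ U′
  unique-prefix []      {U′ = []}      _        _  = refl
  unique-prefix []      {U′ = y ∷ U′} (x∉ ∷ _) refl = ⊥-elim (All.lookup x∉ (∈-++⁺ʳ U′ (here refl)) refl)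
  unique-prefix (y ∷ U) {U′ = []}      (y∉ ∷ _) refl = ⊥-elim (All.lookup y∉ (∈-++⁺ʳ U (here refl)) refl)
  unique-prefix (y ∷ U) {U′ = _ ∷ U′}  (_ ∷ u)  eq =
    cong₂ _∷_ (∷-injectiveˡ eq) (unique-prefix U u (∷-injectiveʳ eq))

  reverse-middle : ∀ (X : List A) a b Y → reverse (X ++ a ∷ b ∷ Y) ≡ reverse Y ++ b ∷ a ∷ reverse X
  reverse-middle X a b Y
    rewrite reverse-++ X (a ∷ b ∷ Y) | unfold-reverse a (b ∷ Y) | unfold-reverse b Y
          | ++-assoc (reverse Y) (b ∷ []) (a ∷ []) = ++-assoc (reverse Y) (b ∷ a ∷ []) (reverse X)

  regroup : ∀ (Y X₁ M X₂ Z : List A) → (Y ++ X₁) ++ M ++ (X₂ ++ Z) ≡ Y ++ (X₁ ++ M ++ X₂) ++ Z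
  regroup Y X₁ M X₂ Z = begin
    (Y ++ X₁) ++ M ++ (X₂ ++ Z)   ≡⟨ ++-assoc Y X₁ _ ⟩
    Y ++ X₁ ++ M ++ (X₂ ++ Z)     ≡⟨ cong (λ R → Y ++ X₁ ++ R) (++-assoc M X₂ Z) ⟨
    Y ++ X₁ ++ (M ++ X₂) ++ Z     ≡⟨ cong (Y ++_) (++-assoc X₁ (M ++ X₂) Z) ⟨
    Y ++ (X₁ ++ M ++ X₂) ++ Z     ∎
    where open ≡-Reasoning

  PrefixComparable : List A → List A → Set
  PrefixComparable xs ys = (∃ λ Z → ys ≡ xs ++ Z) ⊎ (∃ λ Z → xs ≡ ys ++ Z)

  SuffixComparable : List A → List A → Set
  SuffixComparable xs ys = (∃ λ Z → ys ≡ Z ++ xs) ⊎ (∃ λ Z → xs ≡ Z ++ ys)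

  reverse-comparable : ∀ xs ys → PrefixComparable (reverse xs) (reverse ys) → SuffixComparable xs ys
  reverse-comparable xs ys (inj₁ (Z , eq)) = inj₁ (reverse Z , unreverse ys xs Z eq)
    where
    unreverse : ∀ us vs Z → reverse us ≡ reverse vs ++ Z → us ≡ reverse Z ++ vs
    unreverse us vs Z e = trans (sym (reverse-involutive us))
      (trans (cong reverse e) (trans (reverse-++ (reverse vs) Z) (cong (reverse Z ++_) (reverse-involutive vs))))
  reverse-comparable xs ys (inj₂ (Z , eq)) with reverse-comparable ys xs (inj₁ (Z , eq))
  ... | inj₁ (Z′ , eq′) = inj₂ (Z′ , eq′)
  ... | inj₂ (Z′ , eq′) = inj₁ (Z′ , eq′)

  record _⊑_ (S W : List A) : Set where
    constructor split
    field
      before after : List A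
      located      : W ≡ before ++ S ++ after

  ⊑-refl : ∀ {W} → W ⊑ W
  ⊑-refl {W} = split [] [] (sym (++-identityʳ W))

  ⊑-trans : ∀ {S W W′} → S ⊑ W → W ⊑ W′ → S ⊑ W′
  ⊑-trans {S} (split A B refl) (split A′ B′ refl) = split (A′ ++ A) (B ++ B′) (sym (regroup A′ A S B B′))

  ⊑-widen : ∀ Y X₁ M X₂ Z {Left Right} → Left ≡ Y ++ X₁ → Right ≡ X₂ ++ Z →
            (X₁ ++ M ++ X₂) ⊑ (Left ++ M ++ Right)
  ⊑-widen Y X₁ M X₂ Z refl refl = split Y Z (regroup Y X₁ M X₂ Z)

  NoBacktrack : List A → Set
  NoBacktrack (x ∷ y ∷ z ∷ r) = x ≢ z × NoBacktrack (y ∷ z ∷ r)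
  NoBacktrack _               = ⊤

  noBacktrack-tail : ∀ {x} xs → NoBacktrack (x ∷ xs) → NoBacktrack xs
  noBacktrack-tail []          _       = tt
  noBacktrack-tail (_ ∷ [])    _       = tt
  noBacktrack-tail (_ ∷ _ ∷ _) (_ , n) = n

  unique⇒noBacktrack : ∀ {xs} → Unique xs → NoBacktrack xs
  unique⇒noBacktrack {[]}              _                    = tt
  unique⇒noBacktrack {_ ∷ []}          _                    = tt
  unique⇒noBacktrack {_ ∷ _ ∷ []}      _                    = tt
  unique⇒noBacktrack {_ ∷ _ ∷ _ ∷ _} ((_ ∷ x≢z ∷ _) ∷ u) = x≢z , unique⇒noBacktrack u

  noBacktrack-glue : ∀ (xs : List A) {a b ys zs} →
    NoBacktrack (xs ++ a ∷ b ∷ ys) → NoBacktrack (a ∷ b ∷ zs) → NoBacktrack (xs ++ a ∷ b ∷ zs)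
  noBacktrack-glue []              _          n = n
  noBacktrack-glue (_ ∷ [])        (x≢ , _)   n = x≢ , n
  noBacktrack-glue (_ ∷ y ∷ [])    (x≢ , n₁)  n = x≢ , noBacktrack-glue (y ∷ []) n₁ n
  noBacktrack-glue (_ ∷ y ∷ z ∷ xs) (x≢ , n₁) n = x≢ , noBacktrack-glue (y ∷ z ∷ xs) n₁ n

  module _ {R : A → A → Set} where

    linked-++ˡ : ∀ (xs : List A) {ys} → Linked R (xs ++ ys) → Linked R xs
    linked-++ˡ []           _       = []
    linked-++ˡ (_ ∷ [])     _       = [-]
    linked-++ˡ (_ ∷ y ∷ xs) (r ∷ l) = r ∷ linked-++ˡ (y ∷ xs) l

    linked-++ʳ : ∀ (xs : List A) {ys} → Linked R (xs ++ ys) → Linked R ys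
    linked-++ʳ []       l = l
    linked-++ʳ (_ ∷ xs) l = linked-++ʳ xs (Linked.tail l)

    linked-glue : ∀ (xs : List A) {a ys zs} → Linked R (xs ++ a ∷ ys) → Linked R (a ∷ zs) →
                  Linked R (xs ++ a ∷ zs)
    linked-glue []           _        l = l
    linked-glue (_ ∷ [])     (r ∷ _)  l = r ∷ l
    linked-glue (_ ∷ y ∷ xs) (r ∷ l₁) l = r ∷ linked-glue (y ∷ xs) l₁ l

    linked-reverse : (∀ {x y} → R x y → R y x) → ∀ {xs} → Linked R xs → Linked R (reverse xs)
    linked-reverse R-sym []  = []
    linked-reverse R-sym [-] = [-]
    linked-reverse R-sym {x ∷ y ∷ xs} (r ∷ l) =
      subst (Linked R) (sym (reverse-middle [] x y xs))
        (linked-glue (reverse xs) (subst (Linked R) (unfold-reverse y xs) (linked-reverse R-sym l))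
                     (R-sym r ∷ [-]))

  OccursAt : A → ℕ → List A → Set
  OccursAt x j W = ∃₂ λ U V → W ≡ U ++ x ∷ V × length U ≡ j

  occurrence-unique : ∀ {W x j j′} → Unique W → OccursAt x j W → OccursAt x j′ W → j ≡ j′
  occurrence-unique uW (U , _ , refl , refl) (U′ , _ , e , refl) = cong length (unique-prefix U uW e)

argmax : ∀ {B : Set} (L : List B) → L ≢ [] → (h : ∀ {i} → i ∈L L → ℕ) →
         ∃₂ λ v (p : v ∈L L) → ∀ {w} (q : w ∈L L) → h q ≤ h p
argmax []          ne _ = ⊥-elim (ne refl)
argmax (y ∷ [])    _  h = y , here refl , λ { (here refl) → ≤-refl ; (there ()) }
argmax (y ∷ z ∷ L) _  h with argmax (z ∷ L) (λ ()) (h ∘ there)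
... | v , p , hp-max with h (here refl) ≤? h (there p)
...   | yes hy≤ = v , there p , λ { (here refl) → hy≤ ; (there q) → hp-max q }
...   | no  hy≰ = y , here refl , λ { (here refl) → ≤-refl ; (there q) → ≤-trans (hp-max q) (<⇒≤ (≰⇒> hy≰)) }

module _ {k : ℕ} where
  private
    Vx : Set
    Vx = Fin k

  edge-++⁺ˡ : ∀ {a b : Vx} {xs} ys → EdgeOn a b xs → EdgeOn a b (xs ++ ys)
  edge-++⁺ˡ ys here      = here
  edge-++⁺ˡ ys here′     = here′
  edge-++⁺ˡ ys (there e) = there (edge-++⁺ˡ ys e)

  edge-++⁺ʳ : ∀ {a b : Vx} xs {ys} → EdgeOn a b ys → EdgeOn a b (xs ++ ys)
  edge-++⁺ʳ []       e = e
  edge-++⁺ʳ (_ ∷ xs) e = there (edge-++⁺ʳ xs e)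

  edge-sym : ∀ {a b : Vx} {xs} → EdgeOn a b xs → EdgeOn b a xs
  edge-sym here      = here′
  edge-sym here′     = here
  edge-sym (there e) = there (edge-sym e)

  edge-first : ∀ {a b : Vx} {xs} → EdgeOn a b xs → ∃₂ λ x y → ∃ λ rest → xs ≡ x ∷ y ∷ rest
  edge-first (here  {xs}) = _ , _ , xs , refl
  edge-first (here′ {xs}) = _ , _ , xs , refl
  edge-first (there e) with edge-first e
  ... | y , _ , rest , refl = _ , y , _ ∷ rest , refl

  edge-length : ∀ {a b : Vx} {xs} → EdgeOn a b xs → 2 ≤ length xs
  edge-length e with edge-first e
  ... | _ , _ , _ , refl = s≤s (s≤s z≤n)

  edge-∃++ : ∀ {a b : Vx} {xs} → EdgeOn a b xs →
             (∃₂ λ U V → xs ≡ U ++ a ∷ b ∷ V) ⊎ (∃₂ λ U V → xs ≡ U ++ b ∷ a ∷ V)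
  edge-∃++ (here {xs})  = inj₁ ([] , xs , refl)
  edge-∃++ (here′ {xs}) = inj₂ ([] , xs , refl)
  edge-∃++ (there {x} e) with edge-∃++ e
  ... | inj₁ (U , V , refl) = inj₁ (x ∷ U , V , refl)
  ... | inj₂ (U , V , refl) = inj₂ (x ∷ U , V , refl)

  edge-reverse : ∀ {a b : Vx} {xs} → EdgeOn a b xs → EdgeOn a b (reverse xs)
  edge-reverse {a} {b} e with edge-∃++ e
  ... | inj₁ (U , V , refl) = subst (EdgeOn a b) (sym (reverse-middle U a b V)) (edge-++⁺ʳ (reverse V) here′)
  ... | inj₂ (U , V , refl) = subst (EdgeOn a b) (sym (reverse-middle U b a V)) (edge-++⁺ʳ (reverse V) here)

  edge-reverse⁻ : ∀ {a b : Vx} {xs} → EdgeOn a b (reverse xs) → EdgeOn a b xs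
  edge-reverse⁻ {xs = xs} e = subst (EdgeOn _ _) (reverse-involutive xs) (edge-reverse e)

  edge-glue : ∀ {c d : Vx} (xs ws : List Vx) {a ys zs} → EdgeOn c d (xs ++ a ∷ zs) →
              EdgeOn c d (xs ++ a ∷ ys) ⊎ EdgeOn c d (ws ++ a ∷ zs)
  edge-glue []           ws e         = inj₂ (edge-++⁺ʳ ws e)
  edge-glue (_ ∷ [])     ws here      = inj₁ here
  edge-glue (_ ∷ [])     ws here′     = inj₁ here′
  edge-glue (_ ∷ [])     ws (there e) = inj₂ (edge-++⁺ʳ ws e)
  edge-glue (_ ∷ _ ∷ _)  ws here      = inj₁ here
  edge-glue (_ ∷ _ ∷ _)  ws here′     = inj₁ here′
  edge-glue (_ ∷ y ∷ xs) ws (there e) = ⊎-map there id (edge-glue (y ∷ xs) ws e)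

  _⊆E_ : List Vx → List Vx → Set
  xs ⊆E ys = ∀ {a b} → EdgeOn a b xs → EdgeOn a b ys

  _≅E_ : List Vx → List Vx → Set
  xs ≅E ys = xs ⊆E ys × ys ⊆E xs

  ⊑-edges : ∀ {S W : List Vx} → S ⊑ W → S ⊆E W
  ⊑-edges (split A B refl) e = edge-++⁺ʳ A (edge-++⁺ˡ B e)

  record Segment (W P : List Vx) : Set where
    field
      piece  : List Vx
      inside : piece ⊑ W
      toP    : piece ⊆E P
      fromP  : P ⊆E piece

  segment-widen : ∀ {W W′ P} → Segment W P → W ⊑ W′ → Segment W′ P
  segment-widen s W⊑W′ = record { Segment s; inside = ⊑-trans (Segment.inside s) W⊑W′ }

  NoBranch : List Vx → List Vx → Set
  NoBranch P Q = ∀ {x w₁ w₂ w₃} → w₁ ≢ w₂ → w₁ ≢ w₃ → w₂ ≢ w₃ →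
                 EdgeOn x w₁ P → EdgeOn x w₂ P → EdgeOn x w₃ Q → ⊥

  extension : ∀ {P Q} → NoBranch P Q → ∀ a b Ps Qs →
    Unique (a ∷ b ∷ Ps) → Unique (a ∷ b ∷ Qs) → (a ∷ b ∷ Ps) ⊆E P → (a ∷ b ∷ Qs) ⊆E Q →
    PrefixComparable Ps Qs
  extension nb a b []       Qs       _ _ _ _ = inj₁ (Qs , refl)
  extension nb a b (p ∷ Ps) []       _ _ _ _ = inj₂ (p ∷ Ps , refl)
  extension nb a b (p ∷ Ps) (q ∷ Qs) uP uQ sP sQ with p ≟ q
  extension nb a b (p ∷ Ps) (.p ∷ Qs) (_ ∷ uP) (_ ∷ uQ) sP sQ | yes refl
    with extension nb b p Ps Qs uP uQ (sP ∘ there) (sQ ∘ there)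
  ... | inj₁ (Z , eq) = inj₁ (Z , cong (p ∷_) eq)
  ... | inj₂ (Z , eq) = inj₂ (Z , cong (p ∷_) eq)
  extension nb a b (p ∷ Ps) (q ∷ Qs) ((_ ∷ a≢p ∷ _) ∷ _) ((_ ∷ a≢q ∷ _) ∷ _) sP sQ | no p≢q =
    ⊥-elim (nb a≢p a≢q p≢q (sP here′) (sP (there here)) (sQ (there here)))

  EdgeAt : List Vx → ℕ → Vx → Vx → Set
  EdgeAt W j c d = ∃₂ λ U V → W ≡ U ++ c ∷ d ∷ V × length U ≡ j

  UndirectedEdgeAt : List Vx → ℕ → Vx → Vx → Set
  UndirectedEdgeAt W j c d = EdgeAt W j c d ⊎ EdgeAt W j d c

  edgeAt-first : ∀ {W j c d} → EdgeAt W j c d → OccursAt c j W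
  edgeAt-first (U , V , e , eq) = U , _ , e , eq

  edgeAt-second : ∀ {W j c d} → EdgeAt W j c d → OccursAt d (suc j) W
  edgeAt-second {c = c} {d} (U , V , e , refl) =
    U ∷ʳ c , V , trans e (sym (∷ʳ-++ U c (d ∷ V))) , trans (length-++ U) (+-comm (length U) 1)

  edgeAt-reversed : ∀ {W j j′ c d} → Unique W → EdgeAt W j c d → EdgeAt W j′ d c → ⊥
  edgeAt-reversed {j = j} uW p q = m≢1+n+m j {1} (trans j≡1+j′ (cong suc (sym 1+j≡j′)))
    where
    j≡1+j′ = occurrence-unique uW (edgeAt-first p) (edgeAt-second q)
    1+j≡j′ = occurrence-unique uW (edgeAt-second p) (edgeAt-first q)

  edge-position-unique : ∀ {W j j′ c d} → Unique W → UndirectedEdgeAt W j c d → UndirectedEdgeAt W j′ c d → j ≡ j′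
  edge-position-unique uW (inj₁ p) (inj₁ q) = occurrence-unique uW (edgeAt-first p) (edgeAt-first q)
  edge-position-unique uW (inj₂ p) (inj₂ q) = occurrence-unique uW (edgeAt-first p) (edgeAt-first q)
  edge-position-unique uW (inj₁ p) (inj₂ q) = ⊥-elim (edgeAt-reversed uW p q)
  edge-position-unique uW (inj₂ p) (inj₁ q) = ⊥-elim (edgeAt-reversed uW q p)

-- Helly property for blocks of a duplicate-free list.

  Block : List Vx → Set
  Block W = Σ (List Vx) (_⊑ W)

  start end : ∀ {W} → Block W → ℕ
  start (_ , split A _ _) = length A
  end   (S , split A _ _) = length A + length S

  SharesEdge : ∀ {W} → Block W → Block W → Set
  SharesEdge B B′ = ∃₂ λ c d → EdgeOn c d (proj₁ B) × EdgeOn c d (proj₁ B′)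

  last-edge-bound : ∀ (X S₁ : List Vx) {x y S₂} → length (X ++ S₁) + 2 ≤ length X + length (S₁ ++ x ∷ y ∷ S₂)
  last-edge-bound []      []       = s≤s (s≤s z≤n)
  last-edge-bound []      (_ ∷ S₁) = s≤s (last-edge-bound [] S₁)
  last-edge-bound (_ ∷ X) S₁       = s≤s (last-edge-bound X S₁)

  edge-in-block : ∀ {W c d} (B : Block W) → EdgeOn c d (proj₁ B) →
                  ∃ λ j → UndirectedEdgeAt W j c d × start B ≤ j × j + 2 ≤ end B
  edge-in-block {c = c} {d} (S , split A Z refl) e with edge-∃++ e
  ... | inj₁ (S₁ , S₂ , refl) = length (A ++ S₁) ,
          inj₁ (A ++ S₁ , S₂ ++ Z , sym (regroup A S₁ (c ∷ d ∷ []) S₂ Z) , refl) ,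
          length-++-≤ˡ A , last-edge-bound A S₁
  ... | inj₂ (S₁ , S₂ , refl) = length (A ++ S₁) ,
          inj₂ (A ++ S₁ , S₂ ++ Z , sym (regroup A S₁ (d ∷ c ∷ []) S₂ Z) , refl) ,
          length-++-≤ˡ A , last-edge-bound A S₁

  block-contains : ∀ {W j c d} (B : Block W) → EdgeAt W j c d →
                   start B ≤ j → j + 2 ≤ end B → EdgeOn c d (proj₁ B)
  block-contains (S , split A Z refl) (U , _ , e , refl) = inside A S Z U e
    where
    inside : ∀ (X S Y U : List Vx) {c d V} → X ++ S ++ Y ≡ U ++ c ∷ d ∷ V → length X ≤ length U →
             length U + 2 ≤ length X + length S → EdgeOn c d S
    inside []      (_ ∷ _ ∷ _) _ []      refl _ _                = here
    inside []      (_ ∷ [])    _ []      _    _ (s≤s ())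
    inside []      (_ ∷ S)     Y (_ ∷ U) eq   _ (s≤s h)          = there (inside [] S Y U (∷-injectiveʳ eq) z≤n h)
    inside (_ ∷ X) S           Y (_ ∷ U) eq   (s≤s h₁) (s≤s h₂) = inside X S Y U (∷-injectiveʳ eq) h₁ h₂

  block-first-edge : ∀ {W} (B : Block W) → SharesEdge B B → ∃₂ λ x y → EdgeAt W (start B) x y
  block-first-edge (S , split A Z refl) (_ , _ , e , _) with edge-first e
  ... | x , y , rest , refl = x , y , A , rest ++ Z , refl , refl

  blocks-overlap : ∀ {W} → Unique W → (B B′ : Block W) → SharesEdge B B′ → start B + 2 ≤ end B′
  blocks-overlap uW B B′ (_ , _ , e , e′) with edge-in-block B e | edge-in-block B′ e′
  ... | j , at , start≤j , _ | j′ , at′ , _ , j′+2≤end =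
    ≤-trans (+-monoˡ-≤ 2 start≤j) (subst (λ i → i + 2 ≤ end B′) (sym (edge-position-unique uW at at′)) j′+2≤end)

  -- Helly: a non-empty family of blocks pairwise sharing an edge has an edge common to all;
  -- the first edge of a block starting last works.
  helly : ∀ {I : Set} {W} → Unique W → (L : List I) → L ≢ [] → (blk : ∀ {i} → i ∈L L → Block W) →
          (∀ {i j} (p : i ∈L L) (q : j ∈L L) → SharesEdge (blk p) (blk q)) →
          ∃₂ λ c d → ∀ {i} (p : i ∈L L) → EdgeOn c d (proj₁ (blk p))
  helly uW L ne blk shares with argmax L ne (λ p → start (blk p))
  ... | _ , p , starts-last with block-first-edge (blk p) (shares p p)
  ...   | x , y , at = x , y , λ q →
    block-contains (blk q) at (starts-last q) (blocks-overlap uW (blk p) (blk q) (shares p q))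

-- Simple paths in a graph, and how two of them merge when the graph has no cycles.

module _ {k : ℕ} (G : SimpleGraph k) where
  private
    Vx : Set
    Vx = Fin k

  IsSimple : List Vx → Set
  IsSimple xs = Unique xs × Linked (Adj G) xs

  edge-adjacent : ∀ {a b xs} → Linked (Adj G) xs → EdgeOn a b xs → Adj G a b
  edge-adjacent (r ∷ _) here      = r
  edge-adjacent (r ∷ _) here′     = symm G r
  edge-adjacent l       (there e) = edge-adjacent (Linked.tail l) e

  align : ∀ {P a b} → IsSimple P → EdgeOn a b P →
          ∃₂ λ P₁ P₂ → IsSimple (P₁ ++ a ∷ b ∷ P₂) × (P₁ ++ a ∷ b ∷ P₂) ≅E P
  align {a = a} {b} sP e with edge-∃++ e
  ... | inj₁ (P₁ , P₂ , refl) = P₁ , P₂ , sP , (λ e → e) , (λ e → e)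
  ... | inj₂ (P₁ , P₂ , refl) = reverse P₂ , reverse P₁ , simple , toP , fromP
    where
    flipped : reverse (P₁ ++ b ∷ a ∷ P₂) ≡ reverse P₂ ++ a ∷ b ∷ reverse P₁
    flipped = reverse-middle P₁ b a P₂
    simple : IsSimple (reverse P₂ ++ a ∷ b ∷ reverse P₁)
    simple = subst Unique flipped (unique-reverse (proj₁ sP)) ,
             subst (Linked (Adj G)) flipped (linked-reverse (symm G) (proj₂ sP))
    toP : (reverse P₂ ++ a ∷ b ∷ reverse P₁) ⊆E (P₁ ++ b ∷ a ∷ P₂)
    toP e = edge-reverse⁻ (subst (EdgeOn _ _) (sym flipped) e)
    fromP : (P₁ ++ b ∷ a ∷ P₂) ⊆E (reverse P₂ ++ a ∷ b ∷ reverse P₁)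
    fromP e = subst (EdgeOn _ _) flipped (edge-reverse e)

  segment-self : ∀ {P : List Vx} → Segment P P
  segment-self {P} = record { piece = P ; inside = ⊑-refl ; toP = λ e → e ; fromP = λ e → e }

  segment-resp : ∀ {W P P′ : List Vx} → P′ ≅E P → Segment W P′ → Segment W P
  segment-resp (P′⊆P , P⊆P′) s = record
    { piece = piece ; inside = inside ; toP = P′⊆P ∘ toP ; fromP = fromP ∘ P⊆P′ }
    where open Segment s

  nonsplitting⇒noBranch : ∀ {P P′ : Path G} → P ∼ P′ → NoBranch (verts P) (verts P′)
  nonsplitting⇒noBranch (_ , no-split) d₁₂ d₁₃ d₂₃ e₁ e₂ e₃ =
    no-split (_ , _ , _ , _ , d₁₂ , d₁₃ , d₂₃ , inj₁ e₁ , inj₁ e₂ , inj₂ e₃)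

  record Union {I : Set} (𝒫 : I → Path G) (L : List I) : Set where
    field
      whole   : List Vx
      simple  : IsSimple whole
      covered : ∀ {a b} → EdgeOn a b whole → ∃ λ i → i ∈L L × (a , b) ∈E 𝒫 i
      segment : ∀ {i} → i ∈L L → Segment whole (verts (𝒫 i))

  module Acyclic (acyclic : ¬ HasCycle G) where

    no-closed-walk : ∀ x U V → Unique (x ∷ U) → Linked (Adj G) (x ∷ U ++ x ∷ V) →
                     NoBacktrack (x ∷ U ++ x ∷ V) → ⊥
    no-closed-walk x U V u l nb with initLast U
    ... | []            = irrefl G (Linked.head l)
    ... | [] ∷ʳ′ y      = proj₁ nb refl
    ... | (i ∷ I) ∷ʳ′ y = acyclic (x , i ∷ I , y , u , linked-++ˡ (x ∷ (i ∷ I) ∷ʳ y) l , (λ ()) , y~x)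
      where
      y~x : Adj G y x
      y~x = Linked.head (linked-++ʳ (x ∷ i ∷ I)
              (subst (Linked (Adj G)) (cong (λ z → x ∷ i ∷ z) (++-assoc I (y ∷ []) (x ∷ V))) l))

    noBacktrack⇒unique : ∀ xs → Linked (Adj G) xs → NoBacktrack xs → Unique xs
    noBacktrack⇒unique []       _ _  = []
    noBacktrack⇒unique (x ∷ ys) l nb = AllP.¬Any⇒All¬ ys (x∉ys ys l nb uys) ∷ uys
      where
      uys : Unique ys
      uys = noBacktrack⇒unique ys (Linked.tail l) (noBacktrack-tail ys nb)
      x∉ys : ∀ ys → Linked (Adj G) (x ∷ ys) → NoBacktrack (x ∷ ys) → Unique ys → x ∉L ys
      x∉ys ys l nb uys x∈ys with ∈-∃++ x∈ys
      ... | U , V , refl = no-closed-walk x U V (x∉U ∷ unique-++ˡ U uys) l nb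
        where
        x∉U = AllP.¬Any⇒All¬ U (λ x∈U → unique-disjoint U uys x∈U (here refl))

    glue : ∀ X₁ {a b X₂ Y₁ Y₂} → IsSimple (X₁ ++ a ∷ b ∷ X₂) → IsSimple (Y₁ ++ a ∷ b ∷ Y₂) →
           IsSimple (X₁ ++ a ∷ b ∷ Y₂)
    glue X₁ {Y₁ = Y₁} (uX , lX) (uY , lY) =
      noBacktrack⇒unique _ l (noBacktrack-glue X₁ (unique⇒noBacktrack uX) (unique⇒noBacktrack (unique-++ʳ Y₁ uY))) , l
      where
      l = linked-glue X₁ lX (linked-++ʳ Y₁ lY)

    record Merge (W P : List Vx) : Set where
      field
        whole   : List Vx
        simple  : IsSimple whole
        old     : W ⊑ whole
        new     : Segment whole P
        covered : ∀ {c d} → EdgeOn c d whole → EdgeOn c d W ⊎ EdgeOn c d P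

    merge-resp : ∀ {W P P′ : List Vx} → P′ ≅E P → Merge W P′ → Merge W P
    merge-resp P′≅P m = record
      { Merge m ; new = segment-resp {W = Merge.whole m} P′≅P (Merge.new m) ; covered = ⊎-map id (proj₁ P′≅P) ∘ Merge.covered m }

    -- Two simple paths through the same directed edge (a,b), the second not branching off
    -- the first: comparing both directions from (a,b), the union is the longer left part
    -- followed by the longer right part.
    merge-aligned : ∀ Q₁ Q₂ P₁ P₂ {a b} → IsSimple (Q₁ ++ a ∷ b ∷ Q₂) → IsSimple (P₁ ++ a ∷ b ∷ P₂) →
                    NoBranch (P₁ ++ a ∷ b ∷ P₂) (Q₁ ++ a ∷ b ∷ Q₂) →
                    Merge (Q₁ ++ a ∷ b ∷ Q₂) (P₁ ++ a ∷ b ∷ P₂)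
    merge-aligned Q₁ Q₂ P₁ P₂ {a} {b} sW sP nb = combine forward backward
      where
      M = a ∷ b ∷ []
      W = Q₁ ++ a ∷ b ∷ Q₂
      P = P₁ ++ a ∷ b ∷ P₂
      flipW = reverse-middle Q₁ a b Q₂
      flipP = reverse-middle P₁ a b P₂

      forward : PrefixComparable P₂ Q₂
      forward = extension nb a b P₂ Q₂ (unique-++ʳ P₁ (proj₁ sP)) (unique-++ʳ Q₁ (proj₁ sW))
                  (edge-++⁺ʳ P₁) (edge-++⁺ʳ Q₁)

      backward : SuffixComparable P₁ Q₁
      backward = reverse-comparable P₁ Q₁ (extension nb b a (reverse P₁) (reverse Q₁)
        (unique-++ʳ (reverse P₂) (subst Unique flipP (unique-reverse (proj₁ sP))))
        (unique-++ʳ (reverse Q₂) (subst Unique flipW (unique-reverse (proj₁ sW))))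
        (λ e → edge-reverse⁻ {xs = P} (subst (EdgeOn _ _) (sym flipP) (edge-++⁺ʳ (reverse P₂) e)))
        (λ e → edge-reverse⁻ {xs = W} (subst (EdgeOn _ _) (sym flipW) (edge-++⁺ʳ (reverse Q₂) e))))

      combine : PrefixComparable P₂ Q₂ → SuffixComparable P₁ Q₁ → Merge W P
      -- W contains P
      combine (inj₁ (Z , refl)) (inj₁ (Y , refl)) = record
        { whole = W ; simple = sW ; old = ⊑-refl
        ; new = segment-widen segment-self (⊑-widen Y P₁ M P₂ Z refl refl) ; covered = inj₁ }
      -- P contains W
      combine (inj₂ (Z , refl)) (inj₂ (Y , refl)) = record
        { whole = P ; simple = sP ; old = ⊑-widen Y Q₁ M Q₂ Z refl refl
        ; new = segment-self ; covered = inj₂ }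
      -- P extends W to the left, W extends P to the right
      combine (inj₁ (Z , refl)) (inj₂ (Y , refl)) = record
        { whole = P₁ ++ a ∷ b ∷ Q₂ ; simple = glue P₁ sP sW
        ; old = ⊑-widen Y Q₁ M Q₂ [] refl (sym (++-identityʳ Q₂))
        ; new = segment-widen segment-self (⊑-widen [] P₁ M P₂ Z refl refl)
        ; covered = ⊎-swap ∘ edge-glue P₁ Q₁ }
      -- W extends P to the left, P extends W to the right
      combine (inj₂ (Z , refl)) (inj₁ (Y , refl)) = record
        { whole = Q₁ ++ a ∷ b ∷ P₂ ; simple = glue Q₁ sW sP
        ; old = ⊑-widen [] Q₁ M Q₂ Z refl refl
        ; new = segment-widen segment-self (⊑-widen Y P₁ M P₂ [] refl (sym (++-identityʳ P₂)))
        ; covered = edge-glue Q₁ P₁ }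

    merge-at : ∀ Q₁ Q₂ {P a b} → IsSimple (Q₁ ++ a ∷ b ∷ Q₂) → IsSimple P →
               NoBranch P (Q₁ ++ a ∷ b ∷ Q₂) → EdgeOn a b P → Merge (Q₁ ++ a ∷ b ∷ Q₂) P
    merge-at Q₁ Q₂ sW sP nb e with align sP e
    ... | P₁ , P₂ , sP′ , P′≅P = merge-resp P′≅P
            (merge-aligned Q₁ Q₂ P₁ P₂ sW sP′ (λ d₁ d₂ d₃ e₁ e₂ e₃ → nb d₁ d₂ d₃ (proj₁ P′≅P e₁) (proj₁ P′≅P e₂) e₃))

    merge : ∀ {W P c d} → IsSimple W → IsSimple P → NoBranch P W → EdgeOn c d W → EdgeOn c d P → Merge W P
    merge sW sP nb eW eP with edge-∃++ eW
    ... | inj₁ (Q₁ , Q₂ , refl) = merge-at Q₁ Q₂ sW sP nb eP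
    ... | inj₂ (Q₁ , Q₂ , refl) = merge-at Q₁ Q₂ sW sP nb (edge-sym eP)

    union : ∀ {I : Set} (𝒫 : I → Path G) L → L ≢ [] → AllPairs (λ i j → 𝒫 i ∼ 𝒫 j) L → Union 𝒫 L
    union 𝒫 []          ne _ = ⊥-elim (ne refl)
    union 𝒫 (i ∷ [])    _  _ = record
      { whole   = verts (𝒫 i)
      ; simple  = distinct (𝒫 i) , linked (𝒫 i)
      ; covered = λ e → i , here refl , e
      ; segment = λ { (here refl) → segment-self ; (there ()) } }
    union 𝒫 (i ∷ j ∷ L) _  (i∼L ∷ pairs) = record
      { whole   = Merge.whole merged
      ; simple  = Merge.simple merged
      ; covered = [ (λ e → let (j′ , j′∈ , e′) = Union.covered rest e in j′ , there j′∈ , e′)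
                  , (λ e → i , here refl , e) ]′ ∘ Merge.covered merged
      ; segment = λ { (here refl) → Merge.new merged
                    ; (there q)   → segment-widen (Union.segment rest q) (Merge.old merged) } }
      where
      rest = union 𝒫 (j ∷ L) (λ ()) pairs
      onRest : Segment (Union.whole rest) (verts (𝒫 j))
      onRest = Union.segment rest (here refl)
      noBranch : NoBranch (verts (𝒫 i)) (Union.whole rest)
      noBranch d₁₂ d₁₃ d₂₃ e₁ e₂ e₃ with Union.covered rest e₃
      ... | j′ , j′∈ , e₃′ = nonsplitting⇒noBranch {𝒫 i} {𝒫 j′} (All.lookup i∼L j′∈) d₁₂ d₁₃ d₂₃ e₁ e₂ e₃′
      -- 𝒫 i meets 𝒫 j, hence the union built so far
      merged : Merge (Union.whole rest) (verts (𝒫 i))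
      merged = let (_ , _ , onI , onJ) = proj₁ (All.head i∼L) in
        merge (Union.simple rest) (distinct (𝒫 i) , linked (𝒫 i)) noBranch
              (⊑-edges (Segment.inside onRest) (Segment.fromP onRest onJ)) onI

path-edge : ∀ {k} {G : SimpleGraph k} (P : Path G) → ∃₂ λ a b → (a , b) ∈E P
path-edge (mkPath (a ∷ b ∷ _) _ _ _)       = a , b , here
path-edge (mkPath []          _ _ ())
path-edge (mkPath (_ ∷ [])    _ _ (s≤s ()))

members : ∀ {m} → Subset m → List (Fin m)
members {m} K = filter (_∈? K) (allFin m)

members⁺ : ∀ {m} {K : Subset m} {i} → i ∈ K → i ∈L members K
members⁺ {i = i} i∈K = ∈-filter⁺ (_∈? _) (∈-allFin i) i∈K

members⁻ : ∀ {m} {K : Subset m} {i} → i ∈L members K → i ∈ K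
members⁻ {m} {K} p = proj₂ (∈-filter⁻ (_∈? K) {xs = allFin m} p)

members-⊆ : ∀ {m} (K : Subset m) → All (_∈ K) (members K)
members-⊆ {m} K = AllP.all-filter (_∈? K) (allFin m)

members-unique : ∀ {m} (K : Subset m) → Unique (members K)
members-unique {m} K = UniqueP.filter⁺ (_∈? K) (UniqueP.allFin⁺ m)

members-nonempty : ∀ {m} {K : Subset m} {i} → i ∈ K → members K ≢ []
members-nonempty i∈K empty with subst (_ ∈L_) empty (members⁺ i∈K)
... | ()

module _ {k m : ℕ} {T : SimpleGraph k} (𝒫 : Fin m → Path T) {K : Subset m} (clique : IsClique 𝒫 K) where

  -- members of a clique pairwise edge-intersect (a path meets itself in its first edge)
  clique-meet : ∀ {i j} → i ∈ K → j ∈ K → EdgeIntersect (𝒫 i) (𝒫 j)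
  clique-meet {i} {j} i∈K j∈K with i ≟ j
  ... | yes refl = let (a , b , e) = path-edge (𝒫 i) in a , b , e , e
  ... | no  i≢j  = proj₁ (proj₂ (clique i j i∈K j∈K i≢j))

  clique-pairs : ∀ {L} → All (_∈ K) L → Unique L → AllPairs (λ i j → 𝒫 i ∼ 𝒫 j) L
  clique-pairs []            []           = []
  clique-pairs (i∈K ∷ L⊆K) (i∉L ∷ uL) =
    All.zipWith (λ (j∈K , i≢j) → proj₂ (clique _ _ i∈K j∈K i≢j)) (L⊆K , i∉L) ∷ clique-pairs L⊆K uL

lemma1 : {n m : ℕ} (T : SimpleGraph n) → IsTree T →
         (𝒫 : Fin m → Path T) → (K : Subset m) →
         (∃[ v ] v ∈ K) → IsClique 𝒫 K →
         (∃[ a ] ∃[ b ] (Adj T a b × (∀ v → v ∈ K → (a , b) ∈E 𝒫 v)))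
         × (Σ (Path T) λ Q → (∀ a b → ((a , b) ∈E Q) ⇔ (∃[ v ] (v ∈ K × (a , b) ∈E 𝒫 v))))
lemma1 T (_ , acyclic) 𝒫 K (v₀ , v₀∈K) clique = common-edge , union-path
  where
  open Acyclic T acyclic
  L = members K
  L≢[] = members-nonempty v₀∈K
  open Union (union 𝒫 L L≢[] (clique-pairs 𝒫 clique (members-⊆ K) (members-unique K)))
  block : ∀ {i} → i ∈L L → Block whole
  block p = Segment.piece (segment p) , Segment.inside (segment p)
  shares : ∀ {i j} (p : i ∈L L) (q : j ∈L L) → SharesEdge (block p) (block q)
  shares p q = let (a , b , e , e′) = clique-meet 𝒫 clique (members⁻ p) (members⁻ q)
               in a , b , Segment.fromP (segment p) e , Segment.fromP (segment q) e′
  common = helly (proj₁ simple) L L≢[] block shares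
  c = proj₁ common
  d = proj₁ (proj₂ common)
  on : ∀ {v} → v ∈ K → (c , d) ∈E 𝒫 v
  on v∈K = Segment.toP (segment (members⁺ v∈K)) (proj₂ (proj₂ common) (members⁺ v∈K))
  common-edge = c , d , edge-adjacent T (linked (𝒫 v₀)) (on v₀∈K) , λ _ → on
  lift : ∀ {a b v} → v ∈ K → (a , b) ∈E 𝒫 v → EdgeOn a b whole
  lift v∈K = ⊑-edges (Segment.inside (segment (members⁺ v∈K))) ∘ Segment.fromP (segment (members⁺ v∈K))
  union-path = mkPath whole (proj₁ simple) (proj₂ simple) (edge-length (lift v₀∈K (proj₂ (proj₂ (path-edge (𝒫 v₀)))))) ,
               λ a b → mk⇔ (λ e → let (v , p , e′) = covered e in v , members⁻ p , e′)
                           (λ (v , v∈K , e) → lift v∈K e)
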